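{- Let $\Phi$ be a relative simplicial complex with presentation $(\Delta,\Gamma)$ which satisfies $(S_\ell)$, and let $\sigma\in\Delta$. Then $\mathrm{lk}_\Phi(\sigma)$ also satisfies $(S_\ell)$.
   Context: A relative simplicial complex with presentation $(\Delta,\Gamma)$ consists of simplicial complexes $\Gamma\subseteq\Delta$ on a finite vertex set (where $\Gamma$ may be the void complex with no faces); $\Phi=\Delta\setminus\Gamma$. Its reduced homology $\widetilde H_i(\Phi)=\widetilde H_i(\Delta,\Gamma)$ is relative simplicial homology over a fixed field, and $\dim\Phi=\max\{|\tau|-1:\tau\in\Delta\setminus\Gamma\}$. For $\sigma\in\Delta$, $\mathrm{lk}_\Phi(\sigma)$ is the relative complex with presentation $(\mathrm{lk}_\Delta(\sigma),\mathrm{lk}_\Gamma(\sigma))$, where $\mathrm{lk}_\Delta(\sigma)=\{\tau\in\Delta:\tau\cap\sigma=\emptyset,\tau\cup\sigma\in\Delta\}$. $\Phi$ satisfies Serre's condition $(S_\ell)$ if $\widetilde H_{i-1}(\mathrm{lk}_\Phi(\sigma))=0$ for all $\sigma\in\Delta$ and all integers $i\le\min(\dim\mathrm{lk}_\Phi(\sigma),\ell-1)$. -}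

module Defs where

open import Level using (Level; _⊔_)
open import Data.Nat as ℕ using (ℕ; zero; suc; _<_; _<ᵇ_)
open import Data.Fin using (Fin; toℕ)
open import Data.Bool using (Bool; true; false; if_then_else_)
open import Data.Vec using (lookup; tabulate)
open import Data.Fin.Subset using (Subset; _∪_; _∩_; ⁅_⁆; ∣_∣; _⊆_; ⊥)
open import Data.Product using (Σ; _×_; ∃; _,_)
open import Relation.Nullary using (¬_)
open import Relation.Binary.PropositionalEquality using (_≡_)
open import Algebra.Bundles using (CommutativeRing)

record Field (c ℓ : Level) : Set (Level.suc (c ⊔ ℓ)) where
  field
    commRing : CommutativeRing c ℓ
  open CommutativeRing commRing public
  field
    0≉1     : ¬ (0# ≈ 1#)
    inverse : ∀ x → ¬ (x ≈ 0#) → Σ Carrier (λ y → (x * y) ≈ 1#)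

-- Simplicial complexes on the vertex set Fin n (faces = subsets).
-- A complex is a downward-closed family of faces; the void complex
-- (no faces at all) is allowed.

Family : ℕ → Set₁
Family n = Subset n → Set

record IsComplex {n : ℕ} (Δ : Family n) : Set where
  field
    downClosed : ∀ {σ τ} → σ ⊆ τ → Δ τ → Δ σ

record IsRelComplex {n : ℕ} (Δ Γ : Family n) : Set where
  field
    Δ-complex : IsComplex Δ
    Γ-complex : IsComplex Γ
    Γ⊆Δ       : ∀ {σ} → Γ σ → Δ σ

InΦ : {n : ℕ} → Family n → Family n → Family n
InΦ Δ Γ τ = Δ τ × ¬ Γ τ

lk : {n : ℕ} → Family n → Subset n → Family n
lk Δ σ τ = (τ ∩ σ ≡ ⊥) × Δ (τ ∪ σ)

-- C_{j}(Δ,Γ) ≅ k-valued functions on faces of Δ ∖ Γ of cardinality j+1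
-- (the empty face has cardinality 0 and sits in degree -1: reduced chains).
-- The relative boundary is the simplicial boundary followed by the
-- projection killing faces of Γ, i.e. it is only read off on Φ-faces.

module Chains {c ℓ : Level} (k : Field c ℓ) where
  open Field k

  sumFin : (n : ℕ) → (Fin n → Carrier) → Carrier
  sumFin zero    f = 0#
  sumFin (suc n) f = f Data.Fin.zero + sumFin n (λ i → f (Data.Fin.suc i))

  negPow : ℕ → Carrier → Carrier
  negPow zero    x = x
  negPow (suc m) x = - negPow m x

  below : {n : ℕ} → Subset n → Fin n → ℕ
  below {n} ρ v = ∣ ρ ∩ tabulate (λ u → toℕ u <ᵇ toℕ v) ∣

  ∂ : {n : ℕ} → (Subset n → Carrier) → Subset n → Carrier
  ∂ {n} f ρ = sumFin n (λ v → if lookup ρ v then 0# else negPow (below ρ v) (f (ρ ∪ ⁅ v ⁆)))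

  -- a relative chain of Φ = (Δ,Γ) supported on faces of cardinality m
  -- (i.e. a chain in reduced degree m - 1)
  IsChain : {n : ℕ} → Family n → Family n → ℕ → (Subset n → Carrier) → Set ℓ
  IsChain Δ Γ m f = ∀ τ → ¬ (InΦ Δ Γ τ × ∣ τ ∣ ≡ m) → f τ ≈ 0#

  -- H̃_{m-1}(Δ,Γ; k) = 0 : every relative (m-1)-cycle is a relative boundary.
  HomVanishes : {n : ℕ} → Family n → Family n → ℕ → Set (c ⊔ ℓ)
  HomVanishes {n} Δ Γ m =
    (f : Subset n → Carrier) → IsChain Δ Γ m f →
    (∀ ρ → InΦ Δ Γ ρ → suc ∣ ρ ∣ ≡ m → ∂ f ρ ≈ 0#) →
    Σ (Subset n → Carrier) (λ g → IsChain Δ Γ (suc m) g ×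
       (∀ τ → InΦ Δ Γ τ → ∣ τ ∣ ≡ m → ∂ g τ ≈ f τ))

  -- Serre's condition (S_l): for all σ ∈ Δ and all i ≤ min(dim lk_Φ σ, l - 1),
  -- H̃_{i-1}(lk_Φ σ) = 0.  For i < 0 the homology vanishes trivially, so
  -- i ranges over ℕ; "i ≤ dim lk_Φ σ" unfolds to: some face τ of lk_Φ σ has
  -- |τ| - 1 ≥ i; "i ≤ l - 1" is i < l.
  Serre : {n : ℕ} → Family n → Family n → ℕ → Set (c ⊔ ℓ)
  Serre {n} Δ Γ l =
    ∀ σ → Δ σ → ∀ (i : ℕ) → i < l →
    Σ (Subset n) (λ τ → InΦ (lk Δ σ) (lk Γ σ) τ × i < ∣ τ ∣) →
    HomVanishes (lk Δ σ) (lk Γ σ) i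

-- The link of a face τ in lk_Φ(σ) is the link of τ ∪ σ in Φ, for both Δ and Γ,
-- so the relative complexes have the same faces and hence the same homology.
-- Every instance of (S_ℓ) for lk_Φ(σ) at τ is therefore an instance of (S_ℓ)
-- for Φ at τ ∪ σ, which lies in Δ because τ is a face of lk_Δ(σ).
module Submission where

open import Defs
open import Level using (Level)
open import Data.Nat using (ℕ)
open import Data.Fin.Subset using (Subset; _∪_; _∩_; ⊥; _∈_)
open import Data.Fin.Subset.Properties
  using (⊆-antisym; ⊥⊆; p⊆p∪q; q⊆p∪q; ∪-identityˡ; ∪-assoc; ∩-distribˡ-∪; ∩-distribʳ-∪)
open import Data.Product using (_,_; proj₁)
open import Relation.Unary using (_⊆′_; _≐′_)
open import Relation.Unary.Properties using (≐′-sym)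
open import Relation.Binary.PropositionalEquality using (_≡_; sym; trans; cong₂; subst; module ≡-Reasoning)
open ≡-Reasoning

∪≡⊥⇒ˡ : ∀ {n} {x y : Subset n} → x ∪ y ≡ ⊥ → x ≡ ⊥
∪≡⊥⇒ˡ {y = y} x∪y≡⊥ = ⊆-antisym (λ v∈x → subst (_ ∈_) x∪y≡⊥ (p⊆p∪q y v∈x)) ⊥⊆

∪≡⊥⇒ʳ : ∀ {n} {x y : Subset n} → x ∪ y ≡ ⊥ → y ≡ ⊥
∪≡⊥⇒ʳ {x = x} {y} x∪y≡⊥ = ⊆-antisym (λ v∈y → subst (_ ∈_) x∪y≡⊥ (q⊆p∪q x y v∈y)) ⊥⊆

⊥∪⊥≡⊥ : ∀ {n} {x y : Subset n} → x ≡ ⊥ → y ≡ ⊥ → x ∪ y ≡ ⊥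
⊥∪⊥≡⊥ x≡⊥ y≡⊥ = trans (cong₂ _∪_ x≡⊥ y≡⊥) (∪-identityˡ ⊥)

module _ {n : ℕ} (A : Family n) {σ τ : Subset n} (τ∩σ≡⊥ : τ ∩ σ ≡ ⊥) where

  lk-lk⇒lk-∪ : lk (lk A σ) τ ⊆′ lk A (τ ∪ σ)
  lk-lk⇒lk-∪ ρ (ρ∩τ≡⊥ , ρ∪τ∩σ≡⊥ , A[ρ∪τ∪σ]) = ρ∩[τ∪σ]≡⊥ , subst A (∪-assoc ρ τ σ) A[ρ∪τ∪σ]
    where
    ρ∩[τ∪σ]≡⊥ : ρ ∩ (τ ∪ σ) ≡ ⊥
    ρ∩[τ∪σ]≡⊥ = begin
      ρ ∩ (τ ∪ σ)         ≡⟨ ∩-distribˡ-∪ ρ τ σ ⟩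
      (ρ ∩ τ) ∪ (ρ ∩ σ)   ≡⟨ ⊥∪⊥≡⊥ ρ∩τ≡⊥ (∪≡⊥⇒ˡ (trans (sym (∩-distribʳ-∪ σ ρ τ)) ρ∪τ∩σ≡⊥)) ⟩
      ⊥                   ∎

  lk-∪⇒lk-lk : lk A (τ ∪ σ) ⊆′ lk (lk A σ) τ
  lk-∪⇒lk-lk ρ (ρ∩[τ∪σ]≡⊥ , A[ρ∪τ∪σ]) =
    ∪≡⊥⇒ˡ ρ∩τ∪ρ∩σ≡⊥ , ρ∪τ∩σ≡⊥ , subst A (sym (∪-assoc ρ τ σ)) A[ρ∪τ∪σ]
    where
    ρ∩τ∪ρ∩σ≡⊥ : (ρ ∩ τ) ∪ (ρ ∩ σ) ≡ ⊥
    ρ∩τ∪ρ∩σ≡⊥ = trans (sym (∩-distribˡ-∪ ρ τ σ)) ρ∩[τ∪σ]≡⊥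

    ρ∪τ∩σ≡⊥ : (ρ ∪ τ) ∩ σ ≡ ⊥
    ρ∪τ∩σ≡⊥ = begin
      (ρ ∪ τ) ∩ σ         ≡⟨ ∩-distribʳ-∪ σ ρ τ ⟩
      (ρ ∩ σ) ∪ (τ ∩ σ)   ≡⟨ ⊥∪⊥≡⊥ (∪≡⊥⇒ʳ ρ∩τ∪ρ∩σ≡⊥) τ∩σ≡⊥ ⟩
      ⊥                   ∎

  lk-lk≐lk-∪ : lk (lk A σ) τ ≐′ lk A (τ ∪ σ)
  lk-lk≐lk-∪ = lk-lk⇒lk-∪ , lk-∪⇒lk-lk

InΦ-mono : ∀ {n} {A B A' B' : Family n} → A ⊆′ A' → B' ⊆′ B → InΦ A B ⊆′ InΦ A' B'
InΦ-mono A⊆A' B'⊆B ρ (a , ¬b) = A⊆A' ρ a , λ b' → ¬b (B'⊆B ρ b')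

InΦ-cong : ∀ {n} {A B A' B' : Family n} → A ≐′ A' → B ≐′ B' → InΦ A B ≐′ InΦ A' B'
InΦ-cong (A⊆A' , A'⊆A) (B⊆B' , B'⊆B) = InΦ-mono A⊆A' B'⊆B , InΦ-mono A'⊆A B⊆B'

module _ {c ℓ : Level} (k : Field c ℓ) where
  open Chains k

  IsChain-mono : ∀ {n} {A B A' B' : Family n} {m f} →
    InΦ A B ⊆′ InΦ A' B' → IsChain A B m f → IsChain A' B' m f
  IsChain-mono Φ⊆Φ' chain τ τ∉Φ'ₘ = chain τ (λ (τ∈Φ , ∣τ∣≡m) → τ∉Φ'ₘ (Φ⊆Φ' τ τ∈Φ , ∣τ∣≡m))

  HomVanishes-resp : ∀ {n} {A B A' B' : Family n} {m} →
    InΦ A B ≐′ InΦ A' B' → HomVanishes A B m → HomVanishes A' B' m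
  HomVanishes-resp (Φ⊆Φ' , Φ'⊆Φ) vanishes f chain cycle
    with vanishes f (IsChain-mono Φ'⊆Φ chain) (λ ρ ρ∈Φ → cycle ρ (Φ⊆Φ' ρ ρ∈Φ))
  ... | g , g-chain , ∂g≈f = g , IsChain-mono Φ⊆Φ' g-chain , λ τ τ∈Φ' → ∂g≈f τ (Φ'⊆Φ τ τ∈Φ')

lemma4p1 : {c ℓ' : Level} (k : Field c ℓ') (n : ℕ) (Δ Γ : Family n) (l : ℕ) →
    IsRelComplex Δ Γ → Chains.Serre k Δ Γ l →
    (σ : Subset n) → Δ σ → Chains.Serre k (lk Δ σ) (lk Γ σ) l
lemma4p1 k n Δ Γ l _ serre σ _ τ (τ∩σ≡⊥ , Δ[τ∪σ]) i i<l (ρ , ρ∈lkΦ , i<∣ρ∣) =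
  HomVanishes-resp k (≐′-sym links)
    (serre (τ ∪ σ) Δ[τ∪σ] i i<l (ρ , proj₁ links ρ ρ∈lkΦ , i<∣ρ∣))
  where
  links : InΦ (lk (lk Δ σ) τ) (lk (lk Γ σ) τ) ≐′ InΦ (lk Δ (τ ∪ σ)) (lk Γ (τ ∪ σ))
  links = InΦ-cong (lk-lk≐lk-∪ Δ τ∩σ≡⊥) (lk-lk≐lk-∪ Γ τ∩σ≡⊥)
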